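{- For every integer $k\ge 1$, the twincut graph $G_k$ belongs to the class $\mathcal{C}$.
   Context: Let $\mathcal{C}$ be the smallest class of graphs containing all graphs with at most two vertices and closed under the following two operations: (i) substituting a vertex by a stable set of size two (i.e., adding a new vertex with exactly the same neighborhood as an existing vertex and non-adjacent to it); (ii) gluing two graphs of $\mathcal{C}$ along a stable set of size at most two (i.e., taking two graphs $H_1,H_2\in\mathcal{C}$, stable sets $S_1\subseteq V(H_1)$, $S_2\subseteq V(H_2)$ with $|S_1|=|S_2|\le 2$, and a bijection between them, and forming the disjoint union of $H_1$ and $H_2$ with the vertices of $S_1$ identified with the corresponding vertices of $S_2$). A structured tree is a pair $(T,g)$ where $T$ is a rooted tree and $g$ is a function defined on the internal (non-leaf) nodes $v$ of $T$ such that $g(v)$ is a graph whose vertex set is the set of children of $v$ in $T$. A branch of $T$ is a path in $T$ from the root to a leaf. The realization $R(T,g)$ is the graph with vertex set $V(T)\cup B$, where $B$ is a set of new vertices in bijection with the branches of $T$ (called branch vertices). Its edges are: all pairs $uv$ where $u,v$ are children of a common internal node $z$ and $uv$ is an edge of $g(z)$; and, for each branch vertex $b$, all pairs $bw$ with $w$ a node of $T$ lying on the branch $b$. The edges of $T$ itself are not edges of $R(T,g)$. (If $T$ is a single root vertex, $R(T,g)=K_2$.) The twincut graphs $G_1,G_2,\dots$ are defined inductively: $G_1$ is the one-vertex graph; for $k\ge 2$, $G_k=R(T_k,g_k)$ where $T_k$ is the rooted tree with $k-1$ levels (the root is at level $1$) in which every node $v$ at level $i<k-1$ has exactly $|V(G_{i+1})|$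 children and $g_k(v)$ is a copy of $G_{i+1}$ on these children (nodes at level $k-1$ are leaves). -}

module Defs where

open import Data.Nat using (ℕ; zero; suc; _≤_)
open import Data.Fin using (Fin)
open import Data.Unit using (⊤; tt)
open import Data.Empty using (⊥)
open import Data.Product using (Σ; _×_; _,_)
open import Data.Sum using (_⊎_; inj₁; inj₂)
open import Data.List using (List; []; _∷_; [_]; map; length; _++_)
open import Data.List.Membership.Propositional using (_∈_)
open import Relation.Nullary using (¬_)
open import Relation.Binary.PropositionalEquality using (_≡_; refl; subst)
open import Function.Bundles using (_↔_; _⇔_)

-- Simple graphs: a vertex type with a symmetric irreflexive adjacency
-- relation.  (Finiteness is not built in; it is forced for members of
-- the class 𝒞 below, since the base graphs are finite and the
-- operations only add finitely many vertices.)

record Graph : Set₁ where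
  field
    V        : Set
    E        : V → V → Set
    E-sym    : ∀ {x y} → E x y → E y x
    E-irrefl : ∀ {x} → ¬ E x x
open Graph public

record Emb (H G : Graph) : Set where
  field
    f    : V H → V G
    inj  : ∀ {a b} → f a ≡ f b → a ≡ b
    pres : ∀ a b → E H a b ⇔ E G (f a) (f b)
open Emb public

Im : ∀ {H G} → Emb H G → V G → Set
Im {H} e w = Σ (V H) λ a → f e a ≡ w

-- The class 𝒞 (closed under isomorphism by construction).
--
-- twin : G arises from H ∈ 𝒞 by substituting the vertex v of H by a
--        stable set of size two: G is H (embedded induced via e) plus one
--        extra vertex y, non-adjacent to f v, with exactly the same
--        neighbourhood as f v.
-- glue : G arises by gluing H₁, H₂ ∈ 𝒞 along a stable set of size ≤ 2:
--        G is covered by induced copies of H₁ and H₂, every edge of G lies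
--        inside one of the copies, and the copies intersect in a stable
--        set of at most two vertices.

data InC : Graph → Set₁ where
  base : (G : Graph) (n : ℕ) → n ≤ 2 → (V G ↔ Fin n) → InC G
  twin : (H G : Graph) → InC H → (e : Emb H G) → (v : V H) → (y : V G)
       → (∀ a → ¬ (f e a ≡ y))
       → (∀ w → w ≡ y ⊎ Im e w)
       → ¬ E G (f e v) y
       → (∀ w → E G y w ⇔ E G (f e v) w)
       → InC G
  glue : (H₁ H₂ G : Graph) → InC H₁ → InC H₂
       → (e₁ : Emb H₁ G) → (e₂ : Emb H₂ G)
       → (∀ w → Im e₁ w ⊎ Im e₂ w)
       → (∀ w w′ → E G w w′ → (Im e₁ w × Im e₁ w′) ⊎ (Im e₂ w × Im e₂ w′))
       → (Σ (List (V G)) λ L → length L ≤ 2 × (∀ w → Im e₁ w → Im e₂ w → w ∈ L))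
       → (∀ w w′ → Im e₁ w → Im e₂ w → Im e₁ w′ → Im e₂ w′ → ¬ E G w w′)
       → InC G

-- Structured trees: a leaf, or an internal node v carrying a graph g(v)
-- whose vertices are the children of v (each child having a subtree).

data STree : Set₁ where
  leaf : STree
  node : (H : Graph) → (V H → STree) → STree

Node : STree → Set
Node leaf       = ⊤
Node (node H t) = ⊤ ⊎ Σ (V H) λ v → Node (t v)

root : (t : STree) → Node t
root leaf       = tt
root (node H t) = inj₁ tt

IsRoot : (t : STree) → Node t → Set
IsRoot leaf       _        = ⊤
IsRoot (node H t) (inj₁ _) = ⊤
IsRoot (node H t) (inj₂ _) = ⊥

Branch : STree → Set
Branch leaf       = ⊤
Branch (node H t) = Σ (V H) λ v → Branch (t v)

onBranch : (t : STree) → Branch t → List (Node t)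
onBranch leaf       _       = [ tt ]
onBranch (node H t) (v , b) = inj₁ tt ∷ map (λ m → inj₂ (v , m)) (onBranch (t v) b)

-- u ~ w iff u, w are children of a common internal node z and uw ∈ E(g(z))
SibAdj : (t : STree) → Node t → Node t → Set
SibAdj leaf       _                _                = ⊥
SibAdj (node H t) (inj₁ _)         _                = ⊥
SibAdj (node H t) (inj₂ _)         (inj₁ _)         = ⊥
SibAdj (node H t) (inj₂ (v , a))   (inj₂ (w , b))   =
  (IsRoot (t v) a × IsRoot (t w) b × E H v w)
  ⊎ (Σ (v ≡ w) λ p → SibAdj (t w) (subst (λ u → Node (t u)) p a) b)

SibAdj-sym : (t : STree) → ∀ {a b} → SibAdj t a b → SibAdj t b a
SibAdj-sym leaf ()
SibAdj-sym (node H t) {inj₁ _} ()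
SibAdj-sym (node H t) {inj₂ _} {inj₁ _} ()
SibAdj-sym (node H t) {inj₂ (v , a)} {inj₂ (w , b)} (inj₁ (ra , rb , e)) = inj₁ (rb , ra , E-sym H e)
SibAdj-sym (node H t) {inj₂ (v , a)} {inj₂ (.v , b)} (inj₂ (refl , s)) = inj₂ (refl , SibAdj-sym (t v) s)

SibAdj-irrefl : (t : STree) → ∀ {a} → ¬ SibAdj t a a
SibAdj-irrefl leaf ()
SibAdj-irrefl (node H t) {inj₁ _} ()
SibAdj-irrefl (node H t) {inj₂ (v , a)} (inj₁ (_ , _ , e)) = E-irrefl H e
SibAdj-irrefl (node H t) {inj₂ (v , a)} (inj₂ (refl , s)) = SibAdj-irrefl (t v) s

RE : (t : STree) → Node t ⊎ Branch t → Node t ⊎ Branch t → Set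
RE t (inj₁ n) (inj₁ m) = SibAdj t n m
RE t (inj₁ n) (inj₂ b) = n ∈ onBranch t b
RE t (inj₂ b) (inj₁ n) = n ∈ onBranch t b
RE t (inj₂ _) (inj₂ _) = ⊥

RE-sym : (t : STree) → ∀ {x y} → RE t x y → RE t y x
RE-sym t {inj₁ n} {inj₁ m} s = SibAdj-sym t s
RE-sym t {inj₁ n} {inj₂ b} p = p
RE-sym t {inj₂ b} {inj₁ n} p = p
RE-sym t {inj₂ _} {inj₂ _} ()

RE-irrefl : (t : STree) → ∀ {x} → ¬ RE t x x
RE-irrefl t {inj₁ n} s = SibAdj-irrefl t s
RE-irrefl t {inj₂ _} ()

Realization : STree → Graph
Realization t = record
  { V = Node t ⊎ Branch t ; E = RE t ; E-sym = λ {x} {y} → RE-sym t {x} {y} ; E-irrefl = λ {x} → RE-irrefl t {x} }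

K₁ : Graph
K₁ = record { V = ⊤ ; E = λ _ _ → ⊥ ; E-sym = λ () ; E-irrefl = λ () }

-- the tree whose nodes at level i (root = level 1) carry a copy of the
-- i-th graph of the list as g; nodes at level (length + 1) are leaves
levelTree : List Graph → STree
levelTree []       = leaf
levelTree (H ∷ Hs) = node H (λ _ → levelTree Hs)

-- twincutsFrom2 n = [ G₂ , G₃ , … , G_{n+1} ]
twincutsFrom2 : ℕ → List Graph
twincutsFrom2 zero    = []
twincutsFrom2 (suc n) = twincutsFrom2 n ++ [ Realization (levelTree (twincutsFrom2 n)) ]

-- twincut k = G_k for k ≥ 1 (twincut 0 is an unused dummy value).
-- G_k = R(T_k, g_k) with T_k = levelTree [G₂,…,G_{k-1}] for k ≥ 2.
twincut : ℕ → Graph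
twincut zero                = K₁
twincut (suc zero)          = K₁
twincut (suc (suc n))       = Realization (levelTree (twincutsFrom2 n))

-- A realization R(T,g) is assembled from its node graphs by induction on T.
-- At an internal node with graph H and subtrees Tᵥ, start from H on the
-- children together with the isolated root r (a glue along ∅).  The cone at a
-- child v, consisting of r, the subtree at v and the branch vertices through v,
-- is R(Tᵥ) with r added as a twin of the root of Tᵥ; glue it on along the
-- stable set {r, v}.  G_k is the realization of the tree whose levels
-- carry G₂, …, G_{k-1}, so induction on k finishes the proof, provided
-- finiteness is carried along so that the children can be enumerated.

module Submission where

open import Defs
open import Data.Bool using (Bool; true; false; T; _∨_)
open import Data.Bool.Properties using (T-irrelevant; T-∨; T?)
open import Data.Empty using (⊥; ⊥-elim)
open import Data.Fin using (Fin)
open import Data.Fin.Properties using (0↔⊥; 1↔⊤; +↔⊎; *↔×; inj⇒≟)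
open import Data.List using (List; []; _∷_; map; allFin)
open import Data.List.Membership.Propositional using (_∈_)
open import Data.List.Membership.Propositional.Properties using (∈-map⁺; ∈-map⁻; ∈-allFin)
open import Data.List.Relation.Unary.All using (All; []; _∷_)
import Data.List.Relation.Unary.All as All
open import Data.List.Relation.Unary.All.Properties using (++⁺)
open import Data.List.Relation.Unary.Any using (here; there)
open import Data.Nat using (ℕ; zero; suc; _+_; _*_; _≤_; z≤n; s≤s)
open import Data.Product using (∃; _×_; _,_; proj₁; proj₂)
import Data.Product as Prod
open import Data.Product.Function.NonDependent.Propositional using (_×-↔_)
open import Data.Sum using (_⊎_; inj₁; inj₂)
import Data.Sum as Sum
open import Data.Sum.Function.Propositional using (_⊎-↔_)
open import Data.Unit using (⊤; tt)
open import Function using (_∘_; id)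
open import Function.Bundles using (_↔_; _⇔_; mk⇔; Inverse; Equivalence)
open import Function.Properties.Inverse using (↔-sym; ↔-trans; ↔⇒↣)
open import Relation.Binary.Definitions using (DecidableEquality)
open import Relation.Binary.PropositionalEquality using (_≡_; _≢_; refl; sym; cong; subst)
open import Relation.Nullary using (¬_; yes; no)
open import Relation.Nullary.Decidable using (⌊_⌋; toWitness; fromWitness)

Finite : Set → Set
Finite A = ∃ λ n → A ↔ Fin n

finite-⊤ : Finite ⊤
finite-⊤ = 1 , ↔-sym 1↔⊤

finite-⊎ : ∀ {A B} → Finite A → Finite B → Finite (A ⊎ B)
finite-⊎ (m , A↔) (n , B↔) = m + n , ↔-trans (A↔ ⊎-↔ B↔) (↔-sym +↔⊎)

finite-× : ∀ {A B} → Finite A → Finite B → Finite (A × B)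
finite-× (m , A↔) (n , B↔) = m * n , ↔-trans (A↔ ×-↔ B↔) (↔-sym *↔×)

module _ {A : Set} (finite : Finite A) where

  finite-≟ : DecidableEquality A
  finite-≟ = inj⇒≟ (↔⇒↣ (proj₂ finite))

  enumerate : List A
  enumerate = map (Inverse.from (proj₂ finite)) (allFin (proj₁ finite))

  ∈-enumerate : ∀ a → a ∈ enumerate
  ∈-enumerate a = subst (_∈ enumerate) (Inverse.strictlyInverseʳ (proj₂ finite) a)
                        (∈-map⁺ (Inverse.from (proj₂ finite)) (∈-allFin _))

T-∨-introˡ : ∀ {x y} → T x → T (x ∨ y)
T-∨-introˡ {x} {y} = Equivalence.from (T-∨ {x} {y}) ∘ inj₁

T-∨-introʳ : ∀ {x y} → T y → T (x ∨ y)
T-∨-introʳ {x} {y} = Equivalence.from (T-∨ {x} {y}) ∘ inj₂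

T-∨-elim : ∀ {x y} → T (x ∨ y) → T x ⊎ T y
T-∨-elim {x} {y} = Equivalence.to (T-∨ {x} {y})

record Inside (G : Graph) (q : V G → Bool) : Set where
  constructor _,_
  field
    vertex : V G
    inside : T (q vertex)
open Inside

Induced : (G : Graph) → (V G → Bool) → Graph
Induced G q = record
  { V = Inside G q ; E = λ a b → E G (vertex a) (vertex b)
  ; E-sym = E-sym G ; E-irrefl = E-irrefl G }

module _ {G : Graph} where

  induced-≡ : ∀ {q} {a b : Inside G q} → vertex a ≡ vertex b → a ≡ b
  induced-≡ {a = a , p} {.a , p′} refl = cong (a ,_) (T-irrelevant p p′)

  induced-into : ∀ {q} → Emb (Induced G q) G
  induced-into = record { f = vertex ; inj = induced-≡ ; pres = λ _ _ → mk⇔ id id }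

module _ {G : Graph} (p q : V G → Bool) (p⊆q : ∀ w → T (p w) → T (q w)) where

  induced-⊆ : Emb (Induced G p) (Induced G q)
  induced-⊆ = record
    { f = λ (w , pw) → w , p⊆q w pw ; inj = induced-≡ ∘ cong vertex ; pres = λ _ _ → mk⇔ id id }

  induced-⊆-image : ∀ w {qw : T (q w)} → T (p w) → Im induced-⊆ (w , qw)
  induced-⊆-image w pw = (w , pw) , induced-≡ refl

  induced-⊆-image⁻ : ∀ {u} → Im induced-⊆ u → T (p (vertex u))
  induced-⊆-image⁻ ((_ , pw) , refl) = pw

∅ᴳ : Graph
∅ᴳ = record { V = ⊥ ; E = λ () ; E-sym = λ {x} → ⊥-elim x ; E-irrefl = λ {x} → ⊥-elim x }

InC-∅ : InC ∅ᴳ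
InC-∅ = base ∅ᴳ 0 z≤n (↔-sym 0↔⊥)

InC-K₁ : InC K₁
InC-K₁ = base K₁ 1 (s≤s z≤n) (proj₂ finite-⊤)

-- Gluing with the empty graph along the empty set shows that 𝒞 is closed under isomorphism.
InC-≅ : ∀ {H G} → InC H → (e : Emb H G) → (∀ w → Im e w) → InC G
InC-≅ {H} {G} cH e onto =
  glue H ∅ᴳ G cH InC-∅ e e∅ (inj₁ ∘ onto) (λ w w′ _ → inj₁ (onto w , onto w′))
       ([] , z≤n , λ _ _ ()) (λ _ _ _ ())
  where
    e∅ : Emb ∅ᴳ G
    e∅ = record { f = λ () ; inj = λ {a} → ⊥-elim a ; pres = λ () }

InC-induced-≗ : ∀ {G} {p q : V G → Bool}
              → (∀ w → T (p w) → T (q w)) → (∀ w → T (q w) → T (p w))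
              → InC (Induced G p) → InC (Induced G q)
InC-induced-≗ {p = p} {q} p⊆q q⊆p c =
  InC-≅ c (induced-⊆ p q p⊆q) λ (w , qw) → induced-⊆-image p q p⊆q w (q⊆p w qw)

InC-induced-full : ∀ {G q} → (∀ w → T (q w)) → InC (Induced G q) → InC G
InC-induced-full full c = InC-≅ c induced-into λ w → (w , full w) , refl

InC-glue-induced
  : ∀ (G : Graph) {q a b : V G → Bool}
  → (a⊆q : ∀ w → T (a w) → T (q w)) (b⊆q : ∀ w → T (b w) → T (q w))
  → (∀ w → T (q w) → T (a w) ⊎ T (b w))
  → (∀ w w′ → T (q w) → T (q w′) → E G w w′
            → (T (a w) × T (a w′)) ⊎ (T (b w) × T (b w′)))
  → (x y : V G) → T (q x) → T (q y) → ¬ E G x y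
  → (∀ w → T (a w) → T (b w) → w ≡ x ⊎ w ≡ y)
  → InC (Induced G a) → InC (Induced G b) → InC (Induced G q)
InC-glue-induced G {q} {a} {b} a⊆q b⊆q cover edges x y qx qy x≁y a∩b ca cb =
  glue _ _ _ ca cb (induced-⊆ a q a⊆q) (induced-⊆ b q b⊆q)
    (λ (w , qw) → Sum.map (imageᵃ w) (imageᵇ w) (cover w qw))
    (λ (w , qw) (w′ , qw′) ww′ →
      Sum.map (Prod.map (imageᵃ w) (imageᵃ w′)) (Prod.map (imageᵇ w) (imageᵇ w′))
              (edges w w′ qw qw′ ww′))
    ((x , qx) ∷ (y , qy) ∷ [] , s≤s (s≤s z≤n) , λ _ i j → x,y-∈ (meet i j))
    (λ _ _ i j i′ j′ → x,y-stable (meet i j) (meet i′ j′))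
  where
    imageᵃ : ∀ w {qw : T (q w)} → T (a w) → Im (induced-⊆ a q a⊆q) (w , qw)
    imageᵃ = induced-⊆-image a q a⊆q

    imageᵇ : ∀ w {qw : T (q w)} → T (b w) → Im (induced-⊆ b q b⊆q) (w , qw)
    imageᵇ = induced-⊆-image b q b⊆q

    meet : ∀ {u} → Im (induced-⊆ a q a⊆q) u → Im (induced-⊆ b q b⊆q) u
         → vertex u ≡ x ⊎ vertex u ≡ y
    meet {u} i j = a∩b (vertex u) (induced-⊆-image⁻ a q a⊆q i) (induced-⊆-image⁻ b q b⊆q j)

    x,y-∈ : ∀ {u : Inside G q} → vertex u ≡ x ⊎ vertex u ≡ y → u ∈ (x , qx) ∷ (y , qy) ∷ []
    x,y-∈ (inj₁ u≡x) = here (induced-≡ u≡x)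
    x,y-∈ (inj₂ u≡y) = there (here (induced-≡ u≡y))

    x,y-stable : ∀ {u u′} → u ≡ x ⊎ u ≡ y → u′ ≡ x ⊎ u′ ≡ y → ¬ E G u u′
    x,y-stable (inj₁ refl) (inj₁ refl) = E-irrefl G
    x,y-stable (inj₁ refl) (inj₂ refl) = x≁y
    x,y-stable (inj₂ refl) (inj₁ refl) = x≁y ∘ E-sym G
    x,y-stable (inj₂ refl) (inj₂ refl) = E-irrefl G

isRoot? : (t : STree) → Node t → Bool
isRoot? leaf       _        = true
isRoot? (node _ _) (inj₁ _) = true
isRoot? (node _ _) (inj₂ _) = false

isRoot?-root : ∀ t → T (isRoot? t (root t))
isRoot?-root leaf       = tt
isRoot?-root (node _ _) = tt

isRoot?⇒≡root : ∀ t n → T (isRoot? t n) → n ≡ root t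
isRoot?⇒≡root leaf       _        _ = refl
isRoot?⇒≡root (node _ _) (inj₁ _) _ = refl

IsRoot⇒isRoot? : ∀ t n → IsRoot t n → T (isRoot? t n)
IsRoot⇒isRoot? leaf       _        _ = tt
IsRoot⇒isRoot? (node _ _) (inj₁ _) _ = tt

IsRoot-root : ∀ t → IsRoot t (root t)
IsRoot-root leaf       = tt
IsRoot-root (node _ _) = tt

root-¬SibAdj : ∀ t n → ¬ SibAdj t (root t) n
root-¬SibAdj leaf       _ ()
root-¬SibAdj (node _ _) _ ()

root-onBranch : ∀ t b → root t ∈ onBranch t b
root-onBranch leaf       _ = here refl
root-onBranch (node _ _) _ = here refl

InC-K₂ : InC (Realization leaf)
InC-K₂ = base _ 2 (s≤s (s≤s z≤n)) (proj₂ (finite-⊎ finite-⊤ finite-⊤))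

-- cone v: the root r, the subtree at the child v and the branch vertices through v.
-- withCones s: r, all children of r, and the cones at the children in s.
module RealizationOfNode (H : Graph) (finite : Finite (V H)) (t : V H → STree) where

  F : Graph
  F = Realization (node H t)

  _≟_ : DecidableEquality (V H)
  _≟_ = finite-≟ finite

  r : V F
  r = inj₁ (inj₁ tt)

  child : (v : V H) → Node (t v) → V F
  child v n = inj₁ (inj₂ (v , n))

  cone : V H → V F → Bool
  cone v (inj₁ (inj₁ _))       = true
  cone v (inj₁ (inj₂ (w , _))) = ⌊ w ≟ v ⌋
  cone v (inj₂ (w , _))        = ⌊ w ≟ v ⌋

  withCones : (V H → Bool) → V F → Bool
  withCones s (inj₁ (inj₁ _))       = true
  withCones s (inj₁ (inj₂ (w , n))) = s w ∨ isRoot? (t w) n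
  withCones s (inj₂ (w , _))        = s w

  none : V H → Bool
  none _ = false

  insert : V H → (V H → Bool) → V H → Bool
  insert v s w = ⌊ w ≟ v ⌋ ∨ s w

  selected : List (V H) → V H → Bool
  selected []      = none
  selected (v ∷ ℓ) = insert v (selected ℓ)

  ≟-refl : ∀ w → T ⌊ w ≟ w ⌋
  ≟-refl w = fromWitness refl

  ∈-selected : ∀ w {ℓ} → w ∈ ℓ → T (selected ℓ w)
  ∈-selected w (here refl) = T-∨-introˡ (≟-refl w)
  ∈-selected w {v ∷ _} (there w∈ℓ) = T-∨-introʳ {⌊ w ≟ v ⌋} (∈-selected w w∈ℓ)

  withCones-mono : ∀ {s s′} → (∀ w → T (s w) → T (s′ w))
                 → ∀ x → T (withCones s x) → T (withCones s′ x)
  withCones-mono s⊆s′ (inj₁ (inj₁ _))       _ = tt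
  withCones-mono {s} s⊆s′ (inj₁ (inj₂ (w , _))) p =
    Equivalence.from T-∨ (Sum.map₁ (s⊆s′ w) (T-∨-elim {s w} p))
  withCones-mono s⊆s′ (inj₂ (w , _))        p = s⊆s′ w p

  withCones-full : ∀ {s} → (∀ w → T (s w)) → ∀ x → T (withCones s x)
  withCones-full full (inj₁ (inj₁ _))       = tt
  withCones-full full (inj₁ (inj₂ (w , _))) = T-∨-introˡ (full w)
  withCones-full full (inj₂ (w , _))        = full w

  ∈-onBranch⇒same-child : ∀ {u w} {n : Node (t u)} {b : Branch (t w)}
                        → inj₂ (u , n) ∈ onBranch (node H t) (w , b) → u ≡ w
  ∈-onBranch⇒same-child (there m) with ∈-map⁻ _ m
  ... | _ , _ , refl = refl

  ∈-onBranch-child : ∀ {v} {n : Node (t v)} {b}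
                   → n ∈ onBranch (t v) b ⇔ inj₂ (v , n) ∈ onBranch (node H t) (v , b)
  ∈-onBranch-child = mk⇔ (there ∘ ∈-map⁺ _) from
    where
      from : ∀ {v} {n : Node (t v)} {b}
           → inj₂ (v , n) ∈ onBranch (node H t) (v , b) → n ∈ onBranch (t v) b
      from (there m) with ∈-map⁻ _ m
      ... | _ , n∈ , refl = n∈

  node-on-branch-in-cone : ∀ u w {n : Node (t u)} {b : Branch (t w)}
                         → inj₂ (u , n) ∈ onBranch (node H t) (w , b) → T ⌊ u ≟ w ⌋
  node-on-branch-in-cone u w = fromWitness ∘ ∈-onBranch⇒same-child

  edge-in-cone : ∀ x x′ → E F x x′
               → (T (withCones none x) × T (withCones none x′))
               ⊎ ∃ λ w → T (cone w x) × T (cone w x′)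
  edge-in-cone (inj₁ (inj₂ (w , n))) (inj₁ (inj₂ (w′ , n′))) (inj₁ (ρ , ρ′ , _)) =
    inj₁ (IsRoot⇒isRoot? (t w) n ρ , IsRoot⇒isRoot? (t w′) n′ ρ′)
  edge-in-cone (inj₁ (inj₂ (w , _))) (inj₁ (inj₂ (.w , _))) (inj₂ (refl , _)) =
    inj₂ (w , ≟-refl w , ≟-refl w)
  edge-in-cone (inj₁ (inj₁ _)) (inj₂ (w , _)) _ = inj₂ (w , tt , ≟-refl w)
  edge-in-cone (inj₁ (inj₂ (u , _))) (inj₂ (w , _)) m =
    inj₂ (w , node-on-branch-in-cone u w m , ≟-refl w)
  edge-in-cone (inj₂ (w , _)) (inj₁ (inj₁ _)) _ = inj₂ (w , ≟-refl w , tt)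
  edge-in-cone (inj₂ (w , _)) (inj₁ (inj₂ (u , _))) m =
    inj₂ (w , ≟-refl w , node-on-branch-in-cone u w m)

  module Cone (v : V H) where

    embed : Emb (Realization (t v)) (Induced F (cone v))
    embed = record { f = f′ ; inj = inj′ ; pres = pres′ }
      where
        f′ : V (Realization (t v)) → V (Induced F (cone v))
        f′ (inj₁ n) = child v n , ≟-refl v
        f′ (inj₂ b) = inj₂ (v , b) , ≟-refl v

        inj′ : ∀ {a b} → f′ a ≡ f′ b → a ≡ b
        inj′ {inj₁ _} {inj₁ _} refl = refl
        inj′ {inj₂ _} {inj₂ _} refl = refl
        inj′ {inj₁ _} {inj₂ _} ()
        inj′ {inj₂ _} {inj₁ _} ()

        pres′ : ∀ a b → E (Realization (t v)) a b ⇔ E (Induced F (cone v)) (f′ a) (f′ b)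
        pres′ (inj₁ _) (inj₁ _) = mk⇔ (λ s → inj₂ (refl , s))
          λ { (inj₁ (_ , _ , vv)) → ⊥-elim (E-irrefl H vv) ; (inj₂ (refl , s)) → s }
        pres′ (inj₁ _) (inj₂ _) = ∈-onBranch-child
        pres′ (inj₂ _) (inj₁ _) = ∈-onBranch-child
        pres′ (inj₂ _) (inj₂ _) = mk⇔ (λ ()) (λ ())

    cover : ∀ x → x ≡ (r , tt) ⊎ Im embed x
    cover (inj₁ (inj₁ _) , _) = inj₁ refl
    cover (inj₁ (inj₂ (w , n)) , w≟v) with toWitness w≟v
    ... | refl = inj₂ (inj₁ n , induced-≡ refl)
    cover (inj₂ (w , b) , w≟v) with toWitness w≟v
    ... | refl = inj₂ (inj₂ b , induced-≡ refl)

    -- Both r and the root of t v are adjacent exactly to the branch vertices through v.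
    r-twin : ∀ x → E (Induced F (cone v)) (r , tt) x
                 ⇔ E (Induced F (cone v)) (f embed (inj₁ (root (t v)))) x
    r-twin (inj₁ (inj₁ _) , _) = mk⇔ (λ ()) (λ ())
    r-twin (inj₁ (inj₂ (w , n)) , w≟v) with toWitness w≟v
    ... | refl = mk⇔ (λ ())
      λ { (inj₁ (_ , _ , vv)) → E-irrefl H vv ; (inj₂ (refl , s)) → root-¬SibAdj (t v) n s }
    r-twin (inj₂ (w , b) , w≟v) with toWitness w≟v
    ... | refl = mk⇔ (λ _ → there (∈-map⁺ _ (root-onBranch (t v) b))) (λ _ → here refl)

    InC-cone : InC (Realization (t v)) → InC (Induced F (cone v))
    InC-cone c = twin _ _ c embed (inj₁ (root (t v))) (r , tt)
      (λ { (inj₁ _) () ; (inj₂ _) () }) cover (λ ()) r-twin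

  InC-star : InC H → InC (Induced F (withCones none))
  InC-star cH = glue H K₁ _ cH InC-K₁ children root′ cover edges
    ([] , z≤n , λ _ i j → ⊥-elim (disjoint i j)) (λ _ _ i j _ _ _ → disjoint i j)
    where
      children : Emb H (Induced F (withCones none))
      children = record
        { f = λ w → child w (root (t w)) , isRoot?-root (t w)
        ; inj = λ { refl → refl }
        ; pres = λ w w′ → mk⇔ (λ ww′ → inj₁ (IsRoot-root (t w) , IsRoot-root (t w′) , ww′))
            λ { (inj₁ (_ , _ , ww′)) → ww′
              ; (inj₂ (refl , s)) → ⊥-elim (root-¬SibAdj (t w) _ s) } }

      root′ : Emb K₁ (Induced F (withCones none))
      root′ = record { f = λ _ → r , tt ; inj = λ _ → refl ; pres = λ _ _ → mk⇔ (λ ()) (λ ()) }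

      child-image : ∀ w n (ρ : T (isRoot? (t w) n)) → Im children (child w n , ρ)
      child-image w n ρ = w , induced-≡ (cong (child w) (sym (isRoot?⇒≡root (t w) n ρ)))

      cover : ∀ x → Im children x ⊎ Im root′ x
      cover (inj₁ (inj₁ _) , _) = inj₂ (tt , refl)
      cover (inj₁ (inj₂ (w , n)) , ρ) = inj₁ (child-image w n ρ)
      cover (inj₂ _ , ())

      edges : ∀ x x′ → E (Induced F (withCones none)) x x′
            → (Im children x × Im children x′) ⊎ (Im root′ x × Im root′ x′)
      edges (inj₁ (inj₂ (w , n)) , ρ) (inj₁ (inj₂ (w′ , n′)) , ρ′) _ =
        inj₁ (child-image w n ρ , child-image w′ n′ ρ′)
      edges (inj₁ (inj₁ _) , _) (inj₁ _ , _) ()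
      edges (inj₁ (inj₂ _) , _) (inj₁ (inj₁ _) , _) ()
      edges (inj₂ _ , ()) _
      edges (inj₁ _ , _) (inj₂ _ , ())

      disjoint : ∀ {x} → Im children x → Im root′ x → ⊥
      disjoint (_ , refl) (_ , ())

  module _ (v : V H) (s : V H → Bool) where

    insert-other : ∀ w → w ≢ v → T (insert v s w) → T (s w)
    insert-other w w≢v p with T-∨-elim {⌊ w ≟ v ⌋} p
    ... | inj₁ w≟v = ⊥-elim (w≢v (toWitness w≟v))
    ... | inj₂ sw  = sw

    outside-cone : ∀ w x → w ≢ v → T (cone w x) → T (withCones (insert v s) x) → T (withCones s x)
    outside-cone w (inj₁ (inj₁ _)) _ _ _ = tt
    outside-cone w (inj₁ (inj₂ (u , _))) w≢v u≟w p with toWitness u≟w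
    ... | refl = Equivalence.from T-∨ (Sum.map₁ (insert-other w w≢v) (T-∨-elim {insert v s w} p))
    outside-cone w (inj₂ (u , _)) w≢v u≟w p with toWitness u≟w
    ... | refl = insert-other w w≢v p

    by-cone : ∀ w x x′ → T (cone w x) → T (cone w x′)
            → T (withCones (insert v s) x) → T (withCones (insert v s) x′)
            → (T (withCones s x) × T (withCones s x′)) ⊎ (T (cone v x) × T (cone v x′))
    by-cone w x x′ cx cx′ qx qx′ with w ≟ v
    ... | yes refl = inj₂ (cx , cx′)
    ... | no w≢v   = inj₁ (outside-cone w x w≢v cx qx , outside-cone w x′ w≢v cx′ qx′)

    by-cone₁ : ∀ w x → T (cone w x) → T (withCones (insert v s) x) → T (withCones s x) ⊎ T (cone v x)
    by-cone₁ w x cx qx = Sum.map proj₁ proj₁ (by-cone w x x cx cx qx qx)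

    cone-⊆ : ∀ x → T (cone v x) → T (withCones (insert v s) x)
    cone-⊆ (inj₁ (inj₁ _))       _ = tt
    cone-⊆ (inj₁ (inj₂ (w , _))) p = T-∨-introˡ (T-∨-introˡ {⌊ w ≟ v ⌋} {s w} p)
    cone-⊆ (inj₂ (w , _))        p = T-∨-introˡ p

    withCones-⊆-insert : ∀ x → T (withCones s x) → T (withCones (insert v s) x)
    withCones-⊆-insert = withCones-mono (λ w → T-∨-introʳ {⌊ w ≟ v ⌋})

    grow-selected : T (s v) → InC (Induced F (withCones s)) → InC (Induced F (withCones (insert v s)))
    grow-selected sv = InC-induced-≗ withCones-⊆-insert (withCones-mono into-s)
      where
        into-s : ∀ w → T (insert v s w) → T (s w)
        into-s w p with T-∨-elim {⌊ w ≟ v ⌋} p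
        ... | inj₁ w≟v with toWitness w≟v
        ...   | refl = sv
        into-s w p | inj₂ sw = sw

    -- If v is new, the cone at v meets the current graph exactly in r and the child v.
    grow-new : ¬ T (s v) → InC (Induced F (withCones s)) → InC (Realization (t v))
             → InC (Induced F (withCones (insert v s)))
    grow-new ¬sv c cT = InC-glue-induced F withCones-⊆-insert cone-⊆
      cover edges r (child v (root (t v))) tt (cone-⊆ (child v (root (t v))) (≟-refl v)) (λ ())
      meet c (Cone.InC-cone v cT)
      where
        cover : ∀ x → T (withCones (insert v s) x) → T (withCones s x) ⊎ T (cone v x)
        cover (inj₁ (inj₁ _))       _ = inj₁ tt
        cover x@(inj₁ (inj₂ (w , _))) = by-cone₁ w x (≟-refl w)
        cover x@(inj₂ (w , _))        = by-cone₁ w x (≟-refl w)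

        edges : ∀ x x′ → T (withCones (insert v s) x) → T (withCones (insert v s) x′) → E F x x′
              → (T (withCones s x) × T (withCones s x′)) ⊎ (T (cone v x) × T (cone v x′))
        edges x x′ qx qx′ xx′ with edge-in-cone x x′ xx′
        ... | inj₁ (ρ , ρ′) =
          inj₁ (withCones-mono (λ _ ()) x ρ , withCones-mono (λ _ ()) x′ ρ′)
        ... | inj₂ (w , cx , cx′) = by-cone w x x′ cx cx′ qx qx′

        meet : ∀ x → T (withCones s x) → T (cone v x) → x ≡ r ⊎ x ≡ child v (root (t v))
        meet (inj₁ (inj₁ _)) _ _ = inj₁ refl
        meet (inj₁ (inj₂ (w , n))) p w≟v with toWitness w≟v | T-∨-elim {s w} p
        ... | refl | inj₁ sv = ⊥-elim (¬sv sv)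
        ... | refl | inj₂ ρ  = inj₂ (cong (child v) (isRoot?⇒≡root (t v) n ρ))
        meet (inj₂ (w , _)) p w≟v with toWitness w≟v
        ... | refl = ⊥-elim (¬sv p)

    grow : InC (Realization (t v))
         → InC (Induced F (withCones s)) → InC (Induced F (withCones (insert v s)))
    grow cT c with T? (s v)
    ... | yes sv = grow-selected sv c
    ... | no ¬sv = grow-new ¬sv c cT

  InC-realization : InC H → (∀ v → InC (Realization (t v))) → InC F
  InC-realization cH cT =
    InC-induced-full (withCones-full (λ w → ∈-selected w (∈-enumerate finite w)))
                     (InC-selected (enumerate finite))
    where
      InC-selected : ∀ ℓ → InC (Induced F (withCones (selected ℓ)))
      InC-selected []      = InC-star cH
      InC-selected (v ∷ ℓ) = grow v (selected ℓ) (cT v) (InC-selected ℓ)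

FiniteInC : Graph → Set₁
FiniteInC G = InC G × Finite (V G)

data NodeGraphs (P : Graph → Set₁) : STree → Set₁ where
  leaf : NodeGraphs P leaf
  node : ∀ {H t} → P H → (∀ v → NodeGraphs P (t v)) → NodeGraphs P (node H t)

InC-Realization : ∀ {t} → NodeGraphs FiniteInC t → InC (Realization t)
InC-Realization leaf = InC-K₂
InC-Realization (node {H} {t} (cH , finite) ts) =
  RealizationOfNode.InC-realization H finite t cH (InC-Realization ∘ ts)

levelTree-NodeGraphs : ∀ {P Hs} → All P Hs → NodeGraphs P (levelTree Hs)
levelTree-NodeGraphs []       = leaf
levelTree-NodeGraphs (p ∷ ps) = node p (λ _ → levelTree-NodeGraphs ps)

finite-Node-levelTree : ∀ {Hs} → All (Finite ∘ V) Hs → Finite (Node (levelTree Hs))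
finite-Node-levelTree []       = finite-⊤
finite-Node-levelTree (f ∷ fs) = finite-⊎ finite-⊤ (finite-× f (finite-Node-levelTree fs))

finite-Branch-levelTree : ∀ {Hs} → All (Finite ∘ V) Hs → Finite (Branch (levelTree Hs))
finite-Branch-levelTree []       = finite-⊤
finite-Branch-levelTree (f ∷ fs) = finite-× f (finite-Branch-levelTree fs)

FiniteInC-levelTree : ∀ {Hs} → All FiniteInC Hs → FiniteInC (Realization (levelTree Hs))
FiniteInC-levelTree {Hs} gs =
  InC-Realization (levelTree-NodeGraphs gs) ,
  finite-⊎ (finite-Node-levelTree fs) (finite-Branch-levelTree fs)
  where
    fs : All (Finite ∘ V) Hs
    fs = All.map proj₂ gs

FiniteInC-twincutsFrom2 : ∀ n → All FiniteInC (twincutsFrom2 n)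
FiniteInC-twincutsFrom2 zero    = []
FiniteInC-twincutsFrom2 (suc n) =
  ++⁺ (FiniteInC-twincutsFrom2 n) (FiniteInC-levelTree (FiniteInC-twincutsFrom2 n) ∷ [])

proposition3 : (k : ℕ) → 1 ≤ k → InC (twincut k)
proposition3 (suc zero)    _ = InC-K₁
proposition3 (suc (suc n)) _ = proj₁ (FiniteInC-levelTree (FiniteInC-twincutsFrom2 n))
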